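{- There is no strictly descending sequence in $\mathrm{MutualOrd}$: for every $f : \mathbb{N} \to \mathrm{MutualOrd}$ such that $f(i) > f(i+1)$ for all $i : \mathbb{N}$, we obtain an element of the empty type $\bot$.
   Context: Work in cubical type theory (as implemented in cubical Agda); $x \equiv y$ denotes the path type, $A \uplus B$ the coproduct. $\mathrm{MutualOrd} : \mathrm{Type}_0$ is defined simultaneously (inductive-inductive-recursively) with a relation $<$ on it and a function $\mathrm{fst} : \mathrm{MutualOrd} \to \mathrm{MutualOrd}$: its constructors are $\mathbf{0}$ and, for $a, b : \mathrm{MutualOrd}$ and $r : a \geq \mathrm{fst}(b)$, an element $\omega^a + b\,[r]$, where $a \geq b := (b < a) \uplus (a \equiv b)$. The relation $<$ is generated by: $\mathbf{0} < \omega^a + b\,[r]$; if $a < c$ then $\omega^a + b\,[r] < \omega^c + d\,[s]$; if $a \equiv c$ and $b < d$ then $\omega^a + b\,[r] < \omega^c + d\,[s]$. Finally $\mathrm{fst}(\mathbf{0}) = \mathbf{0}$ and $\mathrm{fst}(\omega^a + b\,[r]) = a$. Write $a > b$ for $b < a$. -}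

module Defs where

open import Data.Sum using (_⊎_)
open import Relation.Binary.PropositionalEquality using (_≡_)

data MutualOrd : Set
data _<_ : MutualOrd → MutualOrd → Set
fst : MutualOrd → MutualOrd

infix 30 _<_ _≥_ _>_

_≥_ : MutualOrd → MutualOrd → Set
a ≥ b = (b < a) ⊎ (a ≡ b)

data MutualOrd where
  𝟎 : MutualOrd
  ω^_+_[_] : (a b : MutualOrd) → a ≥ fst b → MutualOrd

data _<_ where
  <₁ : ∀ {a b r} → 𝟎 < ω^ a + b [ r ]
  <₂ : ∀ {a b c d r s} → a < c → ω^ a + b [ r ] < ω^ c + d [ s ]
  <₃ : ∀ {a b c d r s} → a ≡ c → b < d → ω^ a + b [ r ] < ω^ c + d [ s ]

fst 𝟎 = 𝟎
fst (ω^ a + _ [ _ ]) = a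

_>_ : MutualOrd → MutualOrd → Set
a > b = b < a

module Submission where

-- The
-- ordering of ω^ a + b [ r ] is lexicographic in (a , b), so we argue by
-- a nested induction:
--   * ω-accessible: if every term whose leading exponent is below a is
--     accessible, then ω^ a + b [ r ] is accessible whenever b is
--     (inner induction on the accessibility of b);
--   * bounded-accessible: if a is accessible then every x with
--     a ≥ fst x is accessible (outer induction on Acc a, combined with
--     structural recursion on x to obtain accessibility of the tail b);
-- and well-foundedness follows by structural recursion on the exponent.

open import Defs
open import Data.Nat using (ℕ; suc)
open import Data.Empty using (⊥)
open import Data.Product using (∃-syntax; _,_)
open import Data.Sum using (inj₁; inj₂)
open import Function using (_∘_)
open import Level using (Level)
open import Relation.Binary.Core using (Rel)
open import Relation.Binary.PropositionalEquality using (refl)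
open import Induction.WellFounded using (Acc; acc; WellFounded)
open import Induction.InfiniteDescent
  using (InfiniteDescendingSequence; InfiniteDescendingSequenceFrom; Descent; descent∧wf⇒empty)

-- A well-founded relation admits no infinite descending sequence: the
-- property "some descending sequence starts here" always descends.
wf⇒noInfiniteDescent : ∀ {a ℓ : Level} {A : Set a} {_≺_ : Rel A ℓ} →
  WellFounded _≺_ → (f : ℕ → A) → InfiniteDescendingSequence _≺_ f → ⊥
wf⇒noInfiniteDescent {_≺_ = _≺_} wf f desc =
  descent∧wf⇒empty startsDescent wf (f 0) (f , refl , desc)
  where
  startsDescent : Descent _≺_ (λ x → ∃[ g ] InfiniteDescendingSequenceFrom _≺_ g x)
  startsDescent (g , refl , g-desc) = g 1 , g-desc 0 , (g ∘ suc , refl , g-desc ∘ suc)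

Accessible : MutualOrd → Set
Accessible = Acc _<_

𝟎-accessible : Accessible 𝟎
𝟎-accessible = acc λ ()

ω-accessible : ∀ {a} →
  (∀ {c} → c < a → ∀ {d} (s : c ≥ fst d) → Accessible (ω^ c + d [ s ])) →
  ∀ {b} → Accessible b → (r : a ≥ fst b) → Accessible (ω^ a + b [ r ])
ω-accessible below (acc below-b) r = acc λ
  { <₁             → 𝟎-accessible
  ; (<₂ c<a)       → below c<a _
  ; (<₃ refl d<b)  → ω-accessible below (below-b d<b) _
  }

bounded-accessible : ∀ {a} → Accessible a → ∀ x → a ≥ fst x → Accessible x
bounded-accessible _ 𝟎 _ = 𝟎-accessible
bounded-accessible (acc below-a) x@(ω^ _ + _ [ _ ]) (inj₁ c<a) =
  bounded-accessible (below-a c<a) x (inj₂ refl)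
bounded-accessible a-acc@(acc below-a) (ω^ _ + b [ r ]) (inj₂ refl) =
  ω-accessible (λ c<a s → bounded-accessible (below-a c<a) _ (inj₂ refl))
               (bounded-accessible a-acc b r) r

<-wellFounded : WellFounded _<_
<-wellFounded 𝟎                  = 𝟎-accessible
<-wellFounded x@(ω^ a + _ [ _ ]) = bounded-accessible (<-wellFounded a) x (inj₂ refl)

corollary5p4 : (f : ℕ → MutualOrd) → ((i : ℕ) → f i > f (suc i)) → ⊥
corollary5p4 = wf⇒noInfiniteDescent <-wellFounded
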